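{- Let $p$ be a prime and $n\ge1$ an integer such that $\frac{R_n^{(p)}}{n}=\frac{1}{n}\sum_{i=0}^{n-1}p^i\in\mathbb{Z}$. Then for every positive integer $k$, $Z_{p^n}(p^{nk})$ is a base-$p^n$ repdigit with $k$ digits; namely $$Z_{p^n}(p^{nk})=\frac{R_n^{(p)}R_k^{(p^n)}}{n}.$$
   Context: $Z_b(m)$ is the number of trailing zeroes in the base-$b$ expansion of $m!$, i.e. the largest $e\ge0$ with $b^e\mid m!$. The base-$b$ repunit with $k$ digits is $R_k^{(b)}=\sum_{i=0}^{k-1}b^i=\frac{b^k-1}{b-1}$; a base-$b$ repdigit with $k$ digits is a number $\alpha R_k^{(b)}$ with $1\le\alpha\le b-1$. -}

module Defs where

open import Data.Nat using (ℕ; zero; suc; _+_; _*_; _^_; _≤_; _!)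
open import Data.Nat.Divisibility using (_∣_)
open import Data.Product using (_×_; Σ)
open import Relation.Binary.PropositionalEquality using (_≡_)

repunit : ℕ → ℕ → ℕ
repunit b zero    = 0
repunit b (suc k) = b ^ k + repunit b k

-- "e is the number of trailing zeroes of m! in base b", i.e.
-- e is the largest natural number with b^e ∣ m!
IsZ : ℕ → ℕ → ℕ → Set
IsZ b m e = (b ^ e ∣ m !) × (∀ e′ → b ^ e′ ∣ m ! → e′ ≤ e)

IsRepdigit : ℕ → ℕ → ℕ → Set
IsRepdigit b k x = Σ ℕ (λ α → (1 ≤ α) × (α + 1 ≤ b) × (x ≡ α * repunit b k))

module Submission where

-- Call p^v an exact power of p in m (ExactPow p v m) when
-- m = p^v * u with p ∤ u.  For a prime p exact powers multiply, and an exact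
-- power bounds every power of p dividing m.  Legendre's formula for a prime
-- power then follows: in (p*(N+1))! the p - 1 factors after p*N are units,
-- so (p*(N+1))! = (N+1)! * M with p^(N+1) exact in M, and iterating over
-- N = p^m gives that p^(R_m(p)) is exact in (p^m)!.
--   A repunit splits into blocks of n digits: R_(nk)(p) = R_n(p) * R_k(p^n).
-- If R_n(p) = q*n this gives n * (q * R_k(p^n)) = R_(nk)(p), so p^(n*e) with
-- e = q * R_k(p^n) is exact in (p^(nk))!, i.e. (p^(nk))! has exactly e
-- trailing zeroes in base p^n.  Finally q is a nonzero base-p^n digit:
-- q ≥ 1 as R_n(p) > 0, and q ≤ q*n = R_n(p) < p^n.

open import Defs
open import Data.Nat using (ℕ; zero; suc; _+_; _*_; _∸_; _^_; _≤_; _<_; _!; NonZero; z≤n; s≤s; >-nonZero; nonTrivial⇒n>1)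
open import Data.Nat.Properties
open import Data.Nat.Divisibility using (_∣_; divides; ∣1⇒≡1; ∣⇒≤; ∣m+n∣m⇒∣n; m∣m*n; n∣m*n; ∣-trans; *-cancelˡ-∣)
open import Data.Nat.Primality using (Prime; prime; euclidsLemma; prime⇒nonZero)
open import Data.Nat.Tactic.RingSolver using (solve-∀)
open import Data.Product using (Σ; _×_; _,_)
open import Data.Sum using (inj₁; inj₂)
open import Relation.Nullary using (¬_; yes; no; contradiction)
open import Relation.Binary.PropositionalEquality using (_≡_; refl; sym; trans; cong; cong₂; subst; subst₂; module ≡-Reasoning)

prime>1 : ∀ {p} → Prime p → 1 < p
prime>1 {p} (prime {{nontrivial}} _) = nonTrivial⇒n>1 p {{nontrivial}}

prime∤1 : ∀ {p} → Prime p → ¬ p ∣ 1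
prime∤1 pp p∣1 = <⇒≢ (prime>1 pp) (sym (∣1⇒≡1 p∣1))

prime∤* : ∀ {p a b} → Prime p → ¬ p ∣ a → ¬ p ∣ b → ¬ p ∣ a * b
prime∤* {a = a} {b} pp p∤a p∤b p∣ab with euclidsLemma a b pp p∣ab
... | inj₁ p∣a = p∤a p∣a
... | inj₂ p∣b = p∤b p∣b

record ExactPow (p v m : ℕ) : Set where
  constructor exact
  field
    cofactor      : ℕ
    factorisation : m ≡ p ^ v * cofactor
    p∤cofactor    : ¬ p ∣ cofactor

exactPow-* : ∀ {p a b x y} → Prime p → ExactPow p a x → ExactPow p b y → ExactPow p (a + b) (x * y)
exactPow-* {p} {a} {b} pp (exact u refl p∤u) (exact w refl p∤w) =
  exact (u * w) eq (prime∤* pp p∤u p∤w)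
  where
  open ≡-Reasoning
  eq : p ^ a * u * (p ^ b * w) ≡ p ^ (a + b) * (u * w)
  eq = begin
    p ^ a * u * (p ^ b * w)   ≡⟨ rearrange (p ^ a) u (p ^ b) w ⟩
    p ^ a * p ^ b * (u * w)   ≡⟨ cong (_* (u * w)) (sym (^-distribˡ-+-* p a b)) ⟩
    p ^ (a + b) * (u * w)     ∎
    where
    rearrange : ∀ x y z w → x * y * (z * w) ≡ x * z * (y * w)
    rearrange = solve-∀

exactPow-maximal : ∀ {p v m} → Prime p → ExactPow p v m → ∀ e → p ^ e ∣ m → e ≤ v
exactPow-maximal {p} {v} pp (exact u refl p∤u) e p^e∣m with e ≤? v
... | yes e≤v = e≤v
... | no e≰v = contradiction (*-cancelˡ-∣ (p ^ v) {{m^n≢0 p v {{prime⇒nonZero pp}}}} p^v*p∣p^v*u) p∤u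
  where
  p^[1+v]∣p^e : p ^ suc v ∣ p ^ e
  p^[1+v]∣p^e = subst (λ z → p ^ suc v ∣ p ^ z) (m∸n+n≡m (≰⇒> e≰v))
    (subst (p ^ suc v ∣_) (sym (^-distribˡ-+-* p (e ∸ suc v) (suc v))) (n∣m*n (p ^ (e ∸ suc v))))
  p^v*p∣p^v*u : p ^ v * p ∣ p ^ v * u
  p^v*p∣p^v*u = subst (_∣ p ^ v * u) (*-comm p (p ^ v)) (∣-trans p^[1+v]∣p^e p^e∣m)

exactPow-p* : ∀ {p v m} → ExactPow p v m → ExactPow p (suc v) (p * m)
exactPow-p* {p} {v} (exact u refl p∤u) = exact u (sym (*-assoc p (p ^ v) u)) p∤u

exactPow-*-unit : ∀ {p v m c} → Prime p → ExactPow p v m → ¬ p ∣ c → ExactPow p v (m * c)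
exactPow-*-unit {p} {v} {c = c} pp (exact u refl p∤u) p∤c =
  exact (u * c) (*-assoc (p ^ v) u c) (prime∤* pp p∤u p∤c)

-- The j < p factors following p*N in a factorial are not multiples of p:
-- (p*N + j)! = (p*N)! * C with p ∤ C.
factorial-block : ∀ {p} → Prime p → ∀ N j → j < p →
                  Σ ℕ (λ C → ((p * N + j) ! ≡ (p * N) ! * C) × ¬ p ∣ C)
factorial-block {p} pp N zero _ =
  1 , trans (cong _! (+-identityʳ (p * N))) (sym (*-identityʳ _)) , prime∤1 pp
factorial-block {p} pp N (suc j) 1+j<p with factorial-block pp N j (<-trans (n<1+n j) 1+j<p)
... | C , eq , p∤C = suc (p * N + j) * C , eq′ , prime∤* pp p∤next p∤C
  where
  open ≡-Reasoning
  eq′ : (p * N + suc j) ! ≡ (p * N) ! * (suc (p * N + j) * C)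
  eq′ = begin
    (p * N + suc j) !                   ≡⟨ cong _! (+-suc (p * N) j) ⟩
    suc (p * N + j) * (p * N + j) !     ≡⟨ cong (suc (p * N + j) *_) eq ⟩
    suc (p * N + j) * ((p * N) ! * C)   ≡⟨ swap (suc (p * N + j)) ((p * N) !) C ⟩
    (p * N) ! * (suc (p * N + j) * C)   ∎
    where
    swap : ∀ x y z → x * (y * z) ≡ y * (x * z)
    swap = solve-∀
  -- p*N < p*N + j + 1 < p*(N + 1), so this factor is not a multiple of p
  p∤next : ¬ p ∣ suc (p * N + j)
  p∤next p∣next = <⇒≱ 1+j<p (∣⇒≤ (∣m+n∣m⇒∣n (subst (p ∣_) (sym (+-suc (p * N) j)) p∣next) (m∣m*n N)))

-- (p*N)! = N! * M where p^N exactly divides M: among 1, …, p*N the multiples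
-- of p contribute p^N * N!, and all other factors are units.
factorial-p* : ∀ {p} → Prime p → ∀ N → Σ ℕ (λ M → ((p * N) ! ≡ N ! * M) × ExactPow p N M)
factorial-p* {p} pp zero = 1 , cong _! (*-zeroʳ p) , exact 1 refl (prime∤1 pp)
factorial-p* {p} pp (suc N)
  with factorial-p* pp N | factorial-block pp N (p ∸ 1) (∸-monoʳ-< {p} {1} {0} (s≤s z≤n) (<⇒≤ (prime>1 pp)))
... | M , eqM , p^N∥M | C , eqC , p∤C = p * (M * C) , eq , exactPow-p* (exactPow-*-unit pp p^N∥M p∤C)
  where
  open ≡-Reasoning
  p[1+N] : p * suc N ≡ suc (p * N + (p ∸ 1))
  p[1+N] = begin
    p * suc N                 ≡⟨ *-suc p N ⟩
    p + p * N                 ≡⟨ cong (_+ p * N) (sym (m+[n∸m]≡n (<⇒≤ (prime>1 pp)))) ⟩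
    suc (p ∸ 1) + p * N       ≡⟨ cong suc (+-comm (p ∸ 1) (p * N)) ⟩
    suc (p * N + (p ∸ 1))     ∎
  eq : (p * suc N) ! ≡ suc N ! * (p * (M * C))
  eq = begin
    (p * suc N) !                                  ≡⟨ cong _! p[1+N] ⟩
    suc (p * N + (p ∸ 1)) * (p * N + (p ∸ 1)) !   ≡⟨ cong₂ _*_ (sym p[1+N]) eqC ⟩
    p * suc N * ((p * N) ! * C)                    ≡⟨ cong (λ z → p * suc N * (z * C)) eqM ⟩
    p * suc N * (N ! * M * C)                      ≡⟨ rearrange p (suc N) (N !) M C ⟩
    suc N * N ! * (p * (M * C))                    ∎
    where
    rearrange : ∀ a b c d e → a * b * (c * d * e) ≡ b * c * (a * (d * e))
    rearrange = solve-∀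

legendre : ∀ {p} → Prime p → ∀ m → ExactPow p (repunit p m) ((p ^ m) !)
legendre pp zero = exact 1 refl (prime∤1 pp)
legendre {p} pp (suc m) with factorial-p* pp (p ^ m)
... | M , eqM , p^[p^m]∥M =
  subst (ExactPow p (repunit p (suc m))) (sym (trans eqM (*-comm ((p ^ m) !) M)))
        (exactPow-* pp p^[p^m]∥M (legendre pp m))

exact⇒IsZ : ∀ {p n e m} → Prime p → 1 ≤ n → ExactPow p (n * e) (m !) → IsZ (p ^ n) m e
exact⇒IsZ {p} {n} {e} {m} pp 1≤n m!-exact@(exact u m!≡ _) = divides-m! , maximal
  where
  instance
    n≢0 : NonZero n
    n≢0 = >-nonZero 1≤n
  divides-m! : (p ^ n) ^ e ∣ m !
  divides-m! = subst₂ _∣_ (sym (^-*-assoc p n e)) (sym m!≡) (m∣m*n u)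
  maximal : ∀ e′ → (p ^ n) ^ e′ ∣ m ! → e′ ≤ e
  maximal e′ d = *-cancelˡ-≤ n (exactPow-maximal pp m!-exact (n * e′) (subst (_∣ m !) (^-*-assoc p n e′) d))

repunit-+ : ∀ b a c → repunit b (a + c) ≡ b ^ c * repunit b a + repunit b c
repunit-+ b zero    c = cong (_+ repunit b c) (sym (*-zeroʳ (b ^ c)))
repunit-+ b (suc a) c = begin
  b ^ (a + c) + repunit b (a + c)                      ≡⟨ cong₂ _+_ (^-distribˡ-+-* b a c) (repunit-+ b a c) ⟩
  b ^ a * b ^ c + (b ^ c * repunit b a + repunit b c)  ≡⟨ regroup (b ^ a) (b ^ c) (repunit b a) (repunit b c) ⟩
  b ^ c * (b ^ a + repunit b a) + repunit b c          ∎
  where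
  open ≡-Reasoning
  regroup : ∀ x y z w → x * y + (y * z + w) ≡ y * (x + z) + w
  regroup = solve-∀

-- Reading n*k base-b ones as k base-b^n digits each equal to R_n(b):
-- R_(n*k)(b) = R_n(b) * R_k(b^n).
repunit-* : ∀ b n k → repunit b (n * k) ≡ repunit b n * repunit (b ^ n) k
repunit-* b n zero    = trans (cong (repunit b) (*-zeroʳ n)) (sym (*-zeroʳ (repunit b n)))
repunit-* b n (suc k) = begin
  repunit b (n * suc k)                                          ≡⟨ cong (repunit b) (*-suc n k) ⟩
  repunit b (n + n * k)                                          ≡⟨ repunit-+ b n (n * k) ⟩
  b ^ (n * k) * repunit b n + repunit b (n * k)                  ≡⟨ cong₂ (λ u v → u * repunit b n + v) (sym (^-*-assoc b n k)) (repunit-* b n k) ⟩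
  (b ^ n) ^ k * repunit b n + repunit b n * repunit (b ^ n) k    ≡⟨ factor ((b ^ n) ^ k) (repunit b n) (repunit (b ^ n) k) ⟩
  repunit b n * ((b ^ n) ^ k + repunit (b ^ n) k)                ∎
  where
  open ≡-Reasoning
  factor : ∀ x y z → x * y + y * z ≡ y * (x + z)
  factor = solve-∀

repunit-pos : ∀ b n → 1 ≤ repunit b (suc n)
repunit-pos b zero    = s≤s z≤n
repunit-pos b (suc n) = ≤-trans (repunit-pos b n) (m≤n+m _ (b ^ suc n))

repunit-< : ∀ b → 1 < b → ∀ n → repunit b n < b ^ n
repunit-< b 1<b zero    = s≤s z≤n
repunit-< b 1<b (suc n) = begin-strict
  b ^ n + repunit b n   <⟨ +-monoʳ-< (b ^ n) (repunit-< b 1<b n) ⟩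
  b ^ n + b ^ n         ≡⟨ cong (b ^ n +_) (sym (+-identityʳ (b ^ n))) ⟩
  2 * b ^ n             ≤⟨ *-monoˡ-≤ (b ^ n) 1<b ⟩
  b * b ^ n             ∎
  where open ≤-Reasoning

quotient-repdigit : ∀ {b n} → 1 < b → 1 ≤ n → ∀ q → repunit b n ≡ q * n →
                    ∀ k → IsRepdigit (b ^ n) k (q * repunit (b ^ n) k)
quotient-repdigit {b} {suc n} _ _ zero R≡0 _ = contradiction (sym R≡0) (<⇒≢ (repunit-pos b n))
quotient-repdigit {b} {n} 1<b 1≤n q@(suc _) R≡qn _ = q , s≤s z≤n , q<b^n , refl
  where
  open ≤-Reasoning
  instance
    n≢0 : NonZero n
    n≢0 = >-nonZero 1≤n
  q<b^n : q + 1 ≤ b ^ n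
  q<b^n = begin
    q + 1              ≡⟨ +-comm q 1 ⟩
    suc q              ≤⟨ s≤s (m≤m*n q n) ⟩
    suc (q * n)        ≡⟨ cong suc (sym R≡qn) ⟩
    suc (repunit b n)  ≤⟨ repunit-< b 1<b n ⟩
    b ^ n              ∎

proposition3 : (p n : ℕ) → Prime p → 1 ≤ n → (h : n ∣ repunit p n)
    → (k : ℕ) → 1 ≤ k
    → Σ ℕ (λ q → (repunit p n ≡ q * n)
        × IsZ (p ^ n) (p ^ (n * k)) (q * repunit (p ^ n) k)
        × IsRepdigit (p ^ n) k (q * repunit (p ^ n) k))
proposition3 p n pp 1≤n (divides q R≡qn) k _ =
  q , R≡qn , exact⇒IsZ {m = p ^ (n * k)} pp 1≤n p^[n*e]∥factorial , quotient-repdigit (prime>1 pp) 1≤n q R≡qn k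
  where
  open ≡-Reasoning
  n*e≡R : n * (q * repunit (p ^ n) k) ≡ repunit p (n * k)
  n*e≡R = begin
    n * (q * repunit (p ^ n) k)      ≡⟨ sym (*-assoc n q _) ⟩
    n * q * repunit (p ^ n) k        ≡⟨ cong (_* repunit (p ^ n) k) (trans (*-comm n q) (sym R≡qn)) ⟩
    repunit p n * repunit (p ^ n) k  ≡⟨ sym (repunit-* p n k) ⟩
    repunit p (n * k)                ∎
  p^[n*e]∥factorial : ExactPow p (n * (q * repunit (p ^ n) k)) ((p ^ (n * k)) !)
  p^[n*e]∥factorial = subst (λ v → ExactPow p v ((p ^ (n * k)) !)) (sym n*e≡R) (legendre pp (n * k))
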